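{- For every $1\le k\le n$, $\tau(C_k')$ is uniformly distributed among all chord diagrams with $k$ chords on the endpoint set $[2k]$.
   Context: Discrete growth process: fix $2n$ points on a circle labeled $1,\dots,2n$ clockwise. At step $1$, the endpoint $1$ is paired with a partner chosen uniformly at random among the other $2n-1$ points, forming the first chord. At each step $k\ge 2$ ($k\le n$), a pair of distinct points is chosen uniformly at random among the $\binom{2n-2k+2}{2}$ pairs of points not used by the first $k-1$ chords, and joined by a chord. $C_k'$ is the set of the first $k$ chords. For a chord diagram $\mathcal{C}$ with $k$ chords whose endpoint set is $\{i_1<i_2<\dots<i_{2k}\}\subseteq[2n]$, $\tau(\mathcal{C})$ is the chord diagram on $[2k]$ obtained by relabeling $i_t$ as $t$ for every $t\in[2k]$. -}

module Defs where

open import Data.Nat as ℕ using (ℕ; zero; suc; _≡ᵇ_)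
open import Data.Bool using (Bool; true; false; if_then_else_; not; _∨_)
open import Data.List as List using (List; []; _∷_; map; concatMap; filterᵇ; length; upTo; _++_; foldr)
open import Data.Bool.ListAction using (any)
open import Data.List.Properties using (≡-dec)
open import Data.Product using (_×_; _,_; proj₁; proj₂)
open import Data.Rational as ℚ using (ℚ; 0ℚ; 1ℚ)
open import Data.Integer using (+_)
open import Data.Fin using (Fin; toℕ)
open import Data.Vec as Vec using (Vec; lookup; toList)
open import Relation.Nullary using (¬_)
open import Relation.Nullary.Decidable using (⌊_⌋)
open import Relation.Binary.PropositionalEquality using (_≡_)

-- A chord is a pair of point labels (a , b); points are labelled 1 .. 2n.
Chord : Set
Chord = ℕ × ℕ

Dist : Set → Set
Dist A = List (ℚ × A)

uniformOver : {A : Set} → List A → Dist A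
uniformOver [] = []
uniformOver (x ∷ xs) = map (λ y → ((+ 1) ℚ./ suc (length xs)) , y) (x ∷ xs)

bind : {A B : Set} → Dist A → (A → Dist B) → Dist B
bind d f = concatMap (λ pa → map (λ qb → (proj₁ pa ℚ.* proj₁ qb) , proj₂ qb) (f (proj₂ pa))) d

-- the points 1 , 2 , … , 2n (in clockwise order)
points : ℕ → List ℕ
points n = map suc (upTo (2 ℕ.* n))

usedᵇ : List Chord → ℕ → Bool
usedᵇ cs x = any (λ c → (proj₁ c ≡ᵇ x) ∨ (proj₂ c ≡ᵇ x)) cs

freePoints : ℕ → List Chord → List ℕ
freePoints n cs = filterᵇ (λ x → not (usedᵇ cs x)) (points n)

pairsOf : List ℕ → List Chord
pairsOf [] = []
pairsOf (x ∷ xs) = map (x ,_) xs ++ pairsOf xs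

firstStep : ℕ → Dist (List Chord)
firstStep n = uniformOver (map (λ p → (1 , p) ∷ []) (filterᵇ (λ p → not (p ≡ᵇ 1)) (points n)))

laterStep : ℕ → List Chord → Dist (List Chord)
laterStep n cs = map (λ wc → proj₁ wc , (cs ++ proj₂ wc ∷ [])) (uniformOver (pairsOf (freePoints n cs)))

-- distribution of the (ordered) list of the first k chords, i.e. of C_k'
chordsDist : ℕ → ℕ → Dist (List Chord)
chordsDist n zero = (1ℚ , []) ∷ []
chordsDist n (suc zero) = firstStep n
chordsDist n (suc (suc k)) = bind (chordsDist n (suc k)) (laterStep n)

endpoints : ℕ → List Chord → List ℕ
endpoints n cs = filterᵇ (usedᵇ cs) (points n)

indexOf : ℕ → List ℕ → ℕ
indexOf x [] = zero
indexOf x (y ∷ ys) = if y ≡ᵇ x then zero else suc (indexOf x ys)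

partner : List Chord → ℕ → ℕ
partner [] x = x
partner (c ∷ cs) x =
  if proj₁ c ≡ᵇ x then proj₂ c else (if proj₂ c ≡ᵇ x then proj₁ c else partner cs x)

-- τ(cs), encoded as its partner table on [2k] with 0-based labels:
-- the t-th entry (t = 0 … 2k-1) is the (0-based) label of the partner of t.
tau : ℕ → List Chord → List ℕ
tau n cs = map (λ x → indexOf (partner cs x) es) es
  where es = endpoints n cs

-- A chord diagram with k chords on [2k], as its partner table
-- (Fin (2k) element i stands for the point i+1): a fixed-point-free involution.
IsChordDiagram : {m : ℕ} → Vec (Fin m) m → Set
IsChordDiagram {m} D = (i : Fin m) → (lookup D (lookup D i) ≡ i) × (¬ (lookup D i ≡ i))

encode : {m : ℕ} → Vec (Fin m) m → List ℕ
encode D = toList (Vec.map toℕ D)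

probTau : ℕ → (k : ℕ) → Vec (Fin (2 ℕ.* k)) (2 ℕ.* k) → ℚ
probTau n k D =
  foldr ℚ._+_ 0ℚ
    (map (λ wc → if ⌊ ≡-dec ℕ._≟_ (tau n (proj₂ wc)) (encode D) ⌋ then proj₁ wc else 0ℚ)
         (chordsDist n k))

-- Every outcome of the first k steps has the same weight, since the number of choices at each
-- step depends only on the step.  Exchanging two endpoint labels other than 1 maps outcomes to
-- outcomes, is an involution, and conjugates τ by the transposition of the two positions.  So
-- Pr[τ(C_k') = D] does not change when D is conjugated by a transposition of positions other
-- than the first, and such conjugations carry every chord diagram on [2k] to the standard one
-- {1,2}, {3,4}, ….

module Submission where

open import Defs
open import Data.Bool using (Bool; true; false; if_then_else_; not; _∨_; _∧_; T)
open import Data.Bool.Properties using (∨-assoc; ∨-comm; ∨-identityʳ; T?; T-≡)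
open import Data.Empty using (⊥; ⊥-elim)
open import Data.Fin using (Fin; toℕ; fromℕ<)
open import Data.Fin.Properties using (toℕ-fromℕ<; toℕ<n; toℕ-injective)
import Data.Integer as ℤ
open import Data.List as List using (List; []; _∷_; map; filterᵇ; length; applyUpTo; upTo; _++_; _∷ʳ_; foldr; concatMap)
open import Data.List.Membership.Propositional using (_∈_; find; lose)
open import Data.List.Membership.Propositional.Properties using (∈-map⁺; ∈-map⁻; ∈-++⁺ˡ; ∈-++⁺ʳ; ∈-++⁻; ∈-concatMap⁺; ∈-concatMap⁻; ∈-filter⁺; ∈-filter⁻)
open import Data.List.Membership.Propositional.Properties.WithK using (unique∧set⇒bag)
open import Data.List.Properties using (map-∘; map-id; map-id-local; map-cong; map-cong-local; map-++; map-upTo; map-applyUpTo; length-map; length-upTo; length-++; filter-≐; filter-all; ∷-injectiveˡ; ∷-injectiveʳ; ∷ʳ-injectiveˡ; ∷ʳ-injectiveʳ; ≡-dec)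
open import Data.List.Relation.Binary.BagAndSetEquality using (∼bag⇒↭)
open import Data.List.Relation.Binary.Permutation.Propositional using (_↭_; ↭-sym; ↭⇒↭ₛ)
open import Data.List.Relation.Binary.Permutation.Propositional.Properties using (map⁺)
open import Data.List.Relation.Binary.Permutation.Setoid.Properties using (foldr-commMonoid)
open import Data.List.Relation.Unary.All as All using (All; []; _∷_)
open import Data.List.Relation.Unary.All.Properties using (++⁺)
open import Data.List.Relation.Unary.AllPairs as AllPairs using (AllPairs; []; _∷_)
import Data.List.Relation.Unary.AllPairs.Properties as AllPairs
open import Data.List.Relation.Unary.Any using (here; there)
open import Data.List.Relation.Unary.Unique.Propositional using (Unique)
import Data.List.Relation.Unary.Unique.Propositional.Properties as Unique
open import Data.Nat using (ℕ; zero; suc; _≡ᵇ_; _<_; _≤_; s≤s; z≤n; _+_; _*_; _∸_; _⊓_; _⊔_)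
open import Data.Nat.Combinatorics using (_C_; nC1≡n; nCk+nC[k+1]≡[n+1]C[k+1])
open import Data.Nat.Properties using (_≟_; <⇒≢; <⇒≤; ≤-total; ≤∧≢⇒<; ⊓-comm; ⊔-comm; m≤n⇒m⊓n≡m; m≤n⇒m⊔n≡n; <-irrefl; <-asym; +-comm; +-assoc; +-suc; +-identityʳ; *-suc; +-cancelʳ-≡; m+n∸n≡m; ≤-refl; ≤-pred; <-cmp; ≤-<-trans; <-trans; ≤-trans; ≤-antisym; m<n+m; *-monoʳ-≤; n<1+n)
open import Data.Product using (_×_; _,_; proj₁; proj₂; ∃-syntax)
open import Data.Rational as ℚ using (ℚ; 0ℚ; 1ℚ)
import Data.Rational.Properties as ℚ
open import Data.Sum using (_⊎_; inj₁; inj₂)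
open import Data.Vec as Vec using (Vec; lookup; toList)
open import Data.Vec.Properties using (length-toList)
open import Function using (_∘_; _⇔_; mk⇔; Equivalence)
open import Relation.Binary using (Tri; tri<; tri≈; tri>)
open import Relation.Binary.PropositionalEquality
open import Relation.Nullary using (Dec; yes; no)
open import Relation.Nullary.Decidable using (⌊_⌋; does; dec-true; dec-false; does-⇔; isYes≗does)

private
  variable
    A B : Set
    a b i j k m n p s t u v x y z : ℕ
    l : List ℕ
    c : Chord
    cs : List Chord
    f : ℕ → ℕ

-- Transpositions of ℕ

≡ᵇ-true : ∀ {m n} → m ≡ n → (m ≡ᵇ n) ≡ true
≡ᵇ-true = dec-true (_ ≟ _)

≡ᵇ-false : ∀ {m n} → m ≢ n → (m ≡ᵇ n) ≡ false
≡ᵇ-false = dec-false (_ ≟ _)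

≢⇒T-not-≡ᵇ : ∀ {m n} → m ≢ n → T (not (m ≡ᵇ n))
≢⇒T-not-≡ᵇ m≢n rewrite ≡ᵇ-false m≢n = _

T-not-≡ᵇ⇒≢ : ∀ {m n} → T (not (m ≡ᵇ n)) → m ≢ n
T-not-≡ᵇ⇒≢ T[m≢n] m≡n rewrite ≡ᵇ-true m≡n = T[m≢n]

transpose : ℕ → ℕ → ℕ → ℕ
transpose a b z = if z ≡ᵇ a then b else if z ≡ᵇ b then a else z

transpose-left : ∀ a b → transpose a b a ≡ b
transpose-left a b rewrite ≡ᵇ-true (refl {x = a}) = refl

transpose-right : ∀ a b → transpose a b b ≡ a
transpose-right a b with b ≟ a
... | yes refl = transpose-left b b
... | no b≢a rewrite ≡ᵇ-false b≢a | ≡ᵇ-true (refl {x = b}) = refl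

transpose-other : z ≢ a → z ≢ b → transpose a b z ≡ z
transpose-other z≢a z≢b rewrite ≡ᵇ-false z≢a | ≡ᵇ-false z≢b = refl

transpose-preserves : ∀ (P : ℕ → Set) → P a → P b → P z → P (transpose a b z)
transpose-preserves {a} {b} {z} P pa pb pz with z ≟ a | z ≟ b
... | yes refl | _ = subst P (sym (transpose-left z b)) pb
... | no _ | yes refl = subst P (sym (transpose-right a z)) pa
... | no z≢a | no z≢b = subst P (sym (transpose-other z≢a z≢b)) pz

transpose-involutive : ∀ a b z → transpose a b (transpose a b z) ≡ z
transpose-involutive a b z with z ≟ a | z ≟ b
... | yes refl | _ = trans (cong (transpose z b) (transpose-left z b)) (transpose-right z b)
... | no _ | yes refl = trans (cong (transpose a z) (transpose-right a z)) (transpose-left a z)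
... | no z≢a | no z≢b = trans (cong (transpose a b) (transpose-other z≢a z≢b)) (transpose-other z≢a z≢b)

transpose-injective : ∀ a b {x y} → transpose a b x ≡ transpose a b y → x ≡ y
transpose-injective a b {x} {y} eq =
  trans (sym (transpose-involutive a b x)) (trans (cong (transpose a b) eq) (transpose-involutive a b y))

transpose-invariant : ∀ (f : ℕ → A) → f a ≡ f b → ∀ z → f (transpose a b z) ≡ f z
transpose-invariant {a = a} {b = b} f fa≡fb z with z ≟ a | z ≟ b
... | yes refl | _ = trans (cong f (transpose-left z b)) (sym fa≡fb)
... | no _ | yes refl = trans (cong f (transpose-right a z)) fa≡fb
... | no z≢a | no z≢b = cong f (transpose-other z≢a z≢b)

transpose-conjugate : ∀ (f : ℕ → ℕ) a b z → (f z ≡ f a → z ≡ a) → (f z ≡ f b → z ≡ b) →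
                      f (transpose a b z) ≡ transpose (f a) (f b) (f z)
transpose-conjugate f a b z inj-a inj-b with z ≟ a | z ≟ b
... | yes refl | _ = trans (cong f (transpose-left z b)) (sym (transpose-left (f z) (f b)))
... | no _ | yes refl = trans (cong f (transpose-right a z)) (sym (transpose-right (f a) (f z)))
... | no z≢a | no z≢b = trans (cong f (transpose-other z≢a z≢b))
                              (sym (transpose-other (z≢a ∘ inj-a) (z≢b ∘ inj-b)))

≡ᵇ-transpose : ∀ a b u x → (transpose a b u ≡ᵇ x) ≡ (u ≡ᵇ transpose a b x)
≡ᵇ-transpose a b u x = does-⇔ (mk⇔ to from) (transpose a b u ≟ x) (u ≟ transpose a b x)
  where
  to : transpose a b u ≡ x → u ≡ transpose a b x
  to refl = sym (transpose-involutive a b u)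
  from : u ≡ transpose a b x → transpose a b u ≡ x
  from refl = transpose-involutive a b x

conjugate : ℕ → ℕ → (ℕ → ℕ) → ℕ → ℕ
conjugate s t f = transpose s t ∘ f ∘ transpose s t

conjugate-sym : ∀ (f g : ℕ → ℕ) → s < m → t < m →
                (∀ i → i < m → g i ≡ conjugate s t f i) → ∀ i → i < m → conjugate s t g i ≡ f i
conjugate-sym {s} {m} {t} f g s<m t<m g≡ i i<m = begin
  transpose s t (g (transpose s t i))
    ≡⟨ cong (transpose s t) (g≡ _ (transpose-preserves (_< m) s<m t<m i<m)) ⟩
  transpose s t (conjugate s t f (transpose s t i))
    ≡⟨ transpose-involutive s t _ ⟩
  f (transpose s t (transpose s t i))
    ≡⟨ cong f (transpose-involutive s t i) ⟩
  f i  ∎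
  where open ≡-Reasoning

-- Matchings

IsMatching : ℕ → (ℕ → ℕ) → Set
IsMatching m f = ∀ i → i < m → f i < m × f (f i) ≡ i × f i ≢ i

conjugate-matching : s < m → t < m → IsMatching m f → IsMatching m (conjugate s t f)
conjugate-matching {s} {m} {t} {f} s<m t<m match i i<m
  with f[σi]<m , f[f[σi]]≡σi , f[σi]≢σi ← match (transpose s t i) (transpose-preserves (_< m) s<m t<m i<m) =
  transpose-preserves (_< m) s<m t<m f[σi]<m ,
  (begin
    σ (f (σ (σ (f (σ i)))))  ≡⟨ cong (σ ∘ f) (transpose-involutive s t (f (σ i))) ⟩
    σ (f (f (σ i)))          ≡⟨ cong σ f[f[σi]]≡σi ⟩
    σ (σ i)                  ≡⟨ transpose-involutive s t i ⟩
    i                        ∎) ,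
  λ eq → f[σi]≢σi (transpose-injective s t (trans eq (sym (transpose-involutive s t i))))
  where
  open ≡-Reasoning
  σ : ℕ → ℕ
  σ = transpose s t

standardMatching : ℕ → ℕ
standardMatching zero = 1
standardMatching (suc zero) = 0
standardMatching (suc (suc i)) = suc (suc (standardMatching i))

standardMatching-even : ∀ m → standardMatching (2 * m) ≡ suc (2 * m)
standardMatching-even zero = refl
standardMatching-even (suc m) = begin
  standardMatching (2 * suc m)      ≡⟨ cong standardMatching (*-suc 2 m) ⟩
  suc (suc (standardMatching (2 * m)))  ≡⟨ cong (suc ∘ suc) (standardMatching-even m) ⟩
  suc (2 + 2 * m)                   ≡⟨ cong suc (*-suc 2 m) ⟨
  suc (2 * suc m)                   ∎
  where open ≡-Reasoning

standardMatching-odd : ∀ m → standardMatching (suc (2 * m)) ≡ 2 * m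
standardMatching-odd zero = refl
standardMatching-odd (suc m) = begin
  standardMatching (suc (2 * suc m))    ≡⟨ cong (standardMatching ∘ suc) (*-suc 2 m) ⟩
  suc (suc (standardMatching (suc (2 * m))))  ≡⟨ cong (suc ∘ suc) (standardMatching-odd m) ⟩
  2 + 2 * m                             ≡⟨ *-suc 2 m ⟨
  2 * suc m                             ∎
  where open ≡-Reasoning

standardMatching-< : ∀ m {i} → i < 2 * m → standardMatching i < 2 * m
standardMatching-< (suc m) {i} i<2m rewrite *-suc 2 m with i | i<2m
... | zero | _ = s≤s (s≤s z≤n)
... | suc zero | _ = s≤s z≤n
... | suc (suc i) | s≤s (s≤s i<2m′) = s≤s (s≤s (standardMatching-< m i<2m′))

StandardBelow : ℕ → (ℕ → ℕ) → Set
StandardBelow m f = ∀ i → i < 2 * m → f i ≡ standardMatching i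

standardBelow-conjugate : ∀ m f → StandardBelow m f → 2 * m < f (2 * m) → f (f (2 * m)) ≡ 2 * m →
                          StandardBelow (suc m) (conjugate (suc (2 * m)) (f (2 * m)) f)
standardBelow-conjugate m f below D<j f[j]≡D i i<2[1+m] = by-position i i<2[1+m] (<-cmp i (2 * m))
  where
  open ≡-Reasoning
  σ : ℕ → ℕ
  σ = transpose (suc (2 * m)) (f (2 * m))
  fixed : ∀ {x} → x ≤ 2 * m → σ x ≡ x
  fixed x≤D = transpose-other (<⇒≢ (s≤s x≤D)) (<⇒≢ (≤-<-trans x≤D D<j))
  by-position : ∀ i → i < 2 * suc m → Tri (i < 2 * m) (i ≡ 2 * m) (2 * m < i) →
                σ (f (σ i)) ≡ standardMatching i
  by-position i _ (tri< i<D _ _) = begin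
    σ (f (σ i))             ≡⟨ cong (σ ∘ f) (fixed (<⇒≤ i<D)) ⟩
    σ (f i)                 ≡⟨ cong σ (below i i<D) ⟩
    σ (standardMatching i)  ≡⟨ fixed (<⇒≤ (standardMatching-< m i<D)) ⟩
    standardMatching i      ∎
  by-position _ _ (tri≈ _ refl _) = begin
    σ (f (σ (2 * m)))         ≡⟨ cong (σ ∘ f) (fixed ≤-refl) ⟩
    σ (f (2 * m))             ≡⟨ transpose-right (suc (2 * m)) (f (2 * m)) ⟩
    suc (2 * m)               ≡⟨ standardMatching-even m ⟨
    standardMatching (2 * m)  ∎
  by-position i i<2[1+m] (tri> _ _ D<i)
    with refl ← ≤-antisym (≤-pred (subst (i <_) (*-suc 2 m) i<2[1+m])) D<i = begin
    σ (f (σ (suc (2 * m))))         ≡⟨ cong (σ ∘ f) (transpose-left (suc (2 * m)) (f (2 * m))) ⟩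
    σ (f (f (2 * m)))               ≡⟨ cong σ f[j]≡D ⟩
    σ (2 * m)                       ≡⟨ fixed ≤-refl ⟩
    2 * m                           ≡⟨ standardMatching-odd m ⟨
    standardMatching (suc (2 * m))  ∎

-- Step m pairs 2m with 2m+1 by conjugating with the transposition of 2m+1 and f(2m); since
-- f(2m) > 2m, this moves neither 0 nor the pairs already in standard position.
module _ {A : Set} (K : ℕ) (F : (ℕ → ℕ) → A)
         (F-cong : ∀ {f g} → (∀ i → i < 2 * K → f i ≡ g i) → F f ≡ F g)
         (F-conjugate : ∀ {s t} f → 1 ≤ s → 1 ≤ t → s < 2 * K → t < 2 * K → F f ≡ F (conjugate s t f))
         where

  private
    fromStandardBelow : ∀ r m {f} → r + m ≡ K → IsMatching (2 * K) f → StandardBelow m f →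
                        F f ≡ F standardMatching
    fromStandardBelow zero m eq _ below =
      F-cong (λ i i<2K → below i (subst (λ K → i < 2 * K) (sym eq) i<2K))
    fromStandardBelow (suc r) m {f} eq match below =
      trans (F-conjugate f (s≤s z≤n) (≤-trans (s≤s z≤n) D<j) 1+D<2K j<2K)
            (fromStandardBelow r (suc m) (trans (+-suc r m) eq) (conjugate-matching 1+D<2K j<2K match)
                               (standardBelow-conjugate m f below D<j f[j]≡D))
      where
      1+D<2K : suc (2 * m) < 2 * K
      1+D<2K = subst (_≤ 2 * K) (*-suc 2 m) (*-monoʳ-≤ 2 (subst (m <_) eq (m<n+m m (s≤s z≤n))))
      partner-of-D : f (2 * m) < 2 * K × f (f (2 * m)) ≡ 2 * m × f (2 * m) ≢ 2 * m
      partner-of-D = match (2 * m) (<-trans (n<1+n _) 1+D<2K)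
      j<2K : f (2 * m) < 2 * K
      j<2K = proj₁ partner-of-D
      f[j]≡D : f (f (2 * m)) ≡ 2 * m
      f[j]≡D = proj₁ (proj₂ partner-of-D)
      D<j : 2 * m < f (2 * m)
      D<j with <-cmp (2 * m) (f (2 * m))
      ... | tri< D<j _ _ = D<j
      ... | tri≈ _ D≡j _ = ⊥-elim (proj₂ (proj₂ partner-of-D) (sym D≡j))
      ... | tri> _ _ j<D = ⊥-elim (<⇒≢ (standardMatching-< m j<D) (trans (sym (below _ j<D)) f[j]≡D))

  conjugation-invariant⇒standard : IsMatching (2 * K) f → F f ≡ F standardMatching
  conjugation-invariant⇒standard match = fromStandardBelow K 0 (+-identityʳ K) match (λ _ ())

nth : List ℕ → ℕ → ℕ
nth [] _ = 0
nth (x ∷ l) zero = x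
nth (x ∷ l) (suc i) = nth l i

nth-∈ : ∀ l {i} → i < length l → nth l i ∈ l
nth-∈ (x ∷ l) {zero} _ = here refl
nth-∈ (x ∷ l) {suc i} (s≤s i<l) = there (nth-∈ l i<l)

indexOf-nth : ∀ {l} → Unique l → i < length l → indexOf (nth l i) l ≡ i
indexOf-nth {zero} {x ∷ l} _ _ rewrite ≡ᵇ-true (refl {x = x}) = refl
indexOf-nth {suc i} {x ∷ l} (x∉l ∷ u) (s≤s i<l)
  rewrite ≡ᵇ-false (All.lookup x∉l (nth-∈ l i<l)) = cong suc (indexOf-nth u i<l)

nth-indexOf : ∀ y l → indexOf y l < length l → nth l (indexOf y l) ≡ y
nth-indexOf y (x ∷ l) idx<l with x ≟ y
... | yes x≡y rewrite ≡ᵇ-true x≡y = x≡y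
... | no x≢y rewrite ≡ᵇ-false x≢y with s≤s idx<l′ ← idx<l = nth-indexOf y l idx<l′

nth-injective : ∀ {l} → Unique l → i < length l → j < length l → nth l i ≡ nth l j → i ≡ j
nth-injective {i} {j} {l} u i<l j<l eq =
  trans (sym (indexOf-nth u i<l)) (trans (cong (λ y → indexOf y l) eq) (indexOf-nth u j<l))

nth-increasing : ∀ {l} → AllPairs _<_ l → i < j → j < length l → nth l i < nth l j
nth-increasing {zero} {suc j} {x ∷ l} (x<l ∷ _) _ (s≤s j<l) = All.lookup x<l (nth-∈ l j<l)
nth-increasing {suc i} {suc j} {x ∷ l} (_ ∷ l↑) (s≤s i<j) (s≤s j<l) = nth-increasing l↑ i<j j<l

nth-transpose : ∀ {l s t i} → Unique l → s < length l → t < length l → i < length l →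
                nth l (transpose s t i) ≡ transpose (nth l s) (nth l t) (nth l i)
nth-transpose {l} {s} {t} {i} u s<l t<l i<l =
  transpose-conjugate (nth l) s t i (nth-injective u i<l s<l) (nth-injective u i<l t<l)

indexOf-transpose : ∀ {l s t} → Unique l → s < length l → t < length l → ∀ y →
                    indexOf (transpose (nth l s) (nth l t) y) l ≡ transpose s t (indexOf y l)
indexOf-transpose {l} {s} {t} u s<l t<l y = begin
  indexOf (transpose (nth l s) (nth l t) y) l
    ≡⟨ transpose-conjugate (λ z → indexOf z l) (nth l s) (nth l t) y (indexOf-≡ s<l) (indexOf-≡ t<l) ⟩
  transpose (indexOf (nth l s) l) (indexOf (nth l t) l) (indexOf y l)
    ≡⟨ cong₂ (λ s′ t′ → transpose s′ t′ (indexOf y l)) (indexOf-nth u s<l) (indexOf-nth u t<l) ⟩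
  transpose s t (indexOf y l)  ∎
  where
  open ≡-Reasoning
  indexOf-≡ : ∀ {j} → j < length l → indexOf y l ≡ indexOf (nth l j) l → y ≡ nth l j
  indexOf-≡ j<l eq with idx≡j ← trans eq (indexOf-nth u j<l) =
    trans (sym (nth-indexOf y l (subst (_< length l) (sym idx≡j) j<l))) (cong (nth l) idx≡j)

applyUpTo-nth : ∀ l → applyUpTo (nth l) (length l) ≡ l
applyUpTo-nth [] = refl
applyUpTo-nth (x ∷ l) = cong (x ∷_) (applyUpTo-nth l)

applyUpTo-cong : ∀ {f g : ℕ → A} m → (∀ i → i < m → f i ≡ g i) → applyUpTo f m ≡ applyUpTo g m
applyUpTo-cong zero _ = refl
applyUpTo-cong (suc m) f≡g =
  cong₂ _∷_ (f≡g 0 (s≤s z≤n)) (applyUpTo-cong m (λ i i<m → f≡g (suc i) (s≤s i<m)))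

applyUpTo-injective : ∀ {f g : ℕ → A} m → applyUpTo f m ≡ applyUpTo g m → ∀ i → i < m → f i ≡ g i
applyUpTo-injective (suc m) eq zero _ = ∷-injectiveˡ eq
applyUpTo-injective (suc m) eq (suc i) (s≤s i<m) = applyUpTo-injective m (∷-injectiveʳ eq) i i<m

applyUpTo-conjugate : ∀ (f g : ℕ → ℕ) → s < m → t < m →
                      applyUpTo (conjugate s t g) m ≡ applyUpTo f m ⇔
                      applyUpTo g m ≡ applyUpTo (conjugate s t f) m
applyUpTo-conjugate {s} {m} {t} f g s<m t<m = mk⇔
  (λ eq → applyUpTo-cong m λ i i<m →
     sym (conjugate-sym g f s<m t<m (λ j j<m → sym (applyUpTo-injective m eq j j<m)) i i<m))
  (λ eq → applyUpTo-cong m (conjugate-sym f g s<m t<m (applyUpTo-injective m eq)))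

concatMap-unique : ∀ {f : A → List B} {xs} → Unique xs → (∀ x → Unique (f x)) →
                   (∀ {x x′ y} → y ∈ f x → y ∈ f x′ → x ≡ x′) → Unique (concatMap f xs)
concatMap-unique [] _ _ = []
concatMap-unique {f = f} {x ∷ xs} (x∉xs ∷ u) f-unique disjoint =
  Unique.++⁺ (f-unique x) (concatMap-unique u f-unique disjoint) λ (y∈fx , y∈rest) →
    let x′ , x′∈xs , y∈fx′ = find (∈-concatMap⁻ f y∈rest)
    in All.lookup x∉xs x′∈xs (disjoint y∈fx y∈fx′)

filterᵇ-cong : ∀ {p q : A → Bool} → (∀ x → p x ≡ q x) → ∀ xs → filterᵇ p xs ≡ filterᵇ q xs
filterᵇ-cong p≗q =
  filter-≐ (T? ∘ _) (T? ∘ _) ((λ {x} → subst T (p≗q x)) , (λ {x} → subst T (sym (p≗q x))))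

filterᵇ-filterᵇ : ∀ (p q : A → Bool) xs → filterᵇ q (filterᵇ p xs) ≡ filterᵇ (λ x → p x ∧ q x) xs
filterᵇ-filterᵇ p q [] = refl
filterᵇ-filterᵇ p q (x ∷ xs) with p x
... | false = filterᵇ-filterᵇ p q xs
... | true with q x
...   | true = cong (x ∷_) (filterᵇ-filterᵇ p q xs)
...   | false = filterᵇ-filterᵇ p q xs

length-filterᵇ-partition : ∀ (p : A → Bool) xs →
                           length (filterᵇ p xs) + length (filterᵇ (not ∘ p) xs) ≡ length xs
length-filterᵇ-partition p [] = refl
length-filterᵇ-partition p (x ∷ xs) with p x
... | true = cong suc (length-filterᵇ-partition p xs)
... | false = trans (+-suc _ _) (cong suc (length-filterᵇ-partition p xs))

length-filterᵇ-remove : Unique l → x ∈ l → suc (length (filterᵇ (not ∘ (x ≡ᵇ_)) l)) ≡ length l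
length-filterᵇ-remove {w ∷ l} (w∉l ∷ _) (here refl) rewrite ≡ᵇ-true (refl {x = w}) =
  cong (suc ∘ length) (filter-all (T? ∘ _) (All.map ≢⇒T-not-≡ᵇ w∉l))
length-filterᵇ-remove {w ∷ l} (w∉l ∷ u) (there x∈l) rewrite ≡ᵇ-false (All.lookup w∉l x∈l ∘ sym) =
  cong suc (length-filterᵇ-remove u x∈l)

sumℚ : List ℚ → ℚ
sumℚ = foldr ℚ._+_ 0ℚ

sumℚ-↭ : ∀ {xs ys} → xs ↭ ys → sumℚ xs ≡ sumℚ ys
sumℚ-↭ xs↭ys = foldr-commMonoid (setoid ℚ) ℚ.+-0-isCommutativeMonoid (↭⇒↭ₛ xs↭ys)

module _ (f : A → A) {xs : List A} (closed : ∀ {x} → x ∈ xs → f x ∈ xs)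
         (involutive : ∀ {x} → x ∈ xs → f (f x) ≡ x) where

  map-involution-↭ : Unique xs → map f xs ↭ xs
  map-involution-↭ u = ∼bag⇒↭ (unique∧set⇒bag f[xs]-unique u (mk⇔ to from))
    where
    f∘f[xs] : map f (map f xs) ≡ xs
    f∘f[xs] = trans (sym (map-∘ xs)) (map-id-local (All.tabulate involutive))
    f[xs]-unique : Unique (map f xs)
    f[xs]-unique = Unique.map⁻ (subst Unique (sym f∘f[xs]) u)
    to : ∀ {y} → y ∈ map f xs → y ∈ xs
    to y∈ with x , x∈xs , refl ← ∈-map⁻ f y∈ = closed x∈xs
    from : ∀ {y} → y ∈ xs → y ∈ map f xs
    from y∈xs = subst (_∈ map f xs) (involutive y∈xs) (∈-map⁺ f (closed y∈xs))

  sumℚ-map-involution : Unique xs → (g : A → ℚ) → sumℚ (map g xs) ≡ sumℚ (map (g ∘ f) xs)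
  sumℚ-map-involution u g =
    trans (sumℚ-↭ (map⁺ g (↭-sym (map-involution-↭ u)))) (cong sumℚ (sym (map-∘ xs)))

-- Points and chords

Increasing : Chord → Set
Increasing (u , v) = u < v

points-increasing : ∀ n → AllPairs _<_ (points n)
points-increasing n rewrite map-upTo suc (2 * n) =
  AllPairs.applyUpTo⁺₁ suc (2 * n) (λ i<j _ → s≤s i<j)

points-unique : ∀ n → Unique (points n)
points-unique n = AllPairs.map <⇒≢ (points-increasing n)

length-points : ∀ n → length (points n) ≡ 2 * n
length-points n = trans (length-map suc (upTo (2 * n))) (length-upTo (2 * n))

1∈points : x ∈ points n → 1 ∈ points n
1∈points {n = suc n} _ = here refl

points-positive : ∀ n {x} → x ∈ points n → 1 ≤ x
points-positive n x∈ with _ , _ , refl ← ∈-map⁻ suc x∈ = s≤s z≤n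

length-pairsOf : ∀ l → length (pairsOf l) ≡ length l C 2
length-pairsOf [] = refl
length-pairsOf (x ∷ l) = begin
  length (map (x ,_) l ++ pairsOf l)
    ≡⟨ length-++ (map (x ,_) l) ⟩
  length (map (x ,_) l) + length (pairsOf l)
    ≡⟨ cong₂ _+_ (trans (length-map (x ,_) l) (sym (nC1≡n (length l)))) (length-pairsOf l) ⟩
  length l C 1 + length l C 2
    ≡⟨ nCk+nC[k+1]≡[n+1]C[k+1] (length l) 1 ⟩
  suc (length l) C 2  ∎
  where open ≡-Reasoning

∈-pairsOf⁻ : ∀ {R : ℕ → ℕ → Set} {l c} → AllPairs R l → c ∈ pairsOf l →
             proj₁ c ∈ l × proj₂ c ∈ l × R (proj₁ c) (proj₂ c)
∈-pairsOf⁻ {l = x ∷ l} (Rx ∷ Rl) c∈ with ∈-++⁻ (map (x ,_) l) c∈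
... | inj₁ c∈x,l with y , y∈l , refl ← ∈-map⁻ (x ,_) c∈x,l = here refl , there y∈l , All.lookup Rx y∈l
... | inj₂ c∈pairs with x₁∈ , x₂∈ , R₁₂ ← ∈-pairsOf⁻ Rl c∈pairs =
  there x₁∈ , there x₂∈ , R₁₂

∈-pairsOf⁺ : AllPairs _<_ l → x ∈ l → y ∈ l → x < y → (x , y) ∈ pairsOf l
∈-pairsOf⁺ {w ∷ l} (w<l ∷ l↑) (here refl) (here refl) x<y = ⊥-elim (<-irrefl refl x<y)
∈-pairsOf⁺ {w ∷ l} (w<l ∷ l↑) (here refl) (there y∈l) x<y = ∈-++⁺ˡ (∈-map⁺ (w ,_) y∈l)
∈-pairsOf⁺ {w ∷ l} (w<l ∷ l↑) (there x∈l) (here refl) x<y = ⊥-elim (<-asym x<y (All.lookup w<l x∈l))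
∈-pairsOf⁺ {w ∷ l} (w<l ∷ l↑) (there x∈l) (there y∈l) x<y =
  ∈-++⁺ʳ (map (w ,_) l) (∈-pairsOf⁺ l↑ x∈l y∈l x<y)

pairsOf-unique : Unique l → Unique (pairsOf l)
pairsOf-unique {[]} [] = []
pairsOf-unique {x ∷ l} (x∉l ∷ u) =
  Unique.++⁺ (Unique.map⁺ (cong proj₂) u) (pairsOf-unique u) disjoint
  where
  disjoint : ∀ {c} → c ∈ map (x ,_) l × c ∈ pairsOf l → ⊥
  disjoint (c∈x,l , c∈pairs) with _ , _ , refl ← ∈-map⁻ (x ,_) c∈x,l =
    All.lookup x∉l (proj₁ (∈-pairsOf⁻ u c∈pairs)) refl

endsAtᵇ : Chord → ℕ → Bool
endsAtᵇ (u , v) x = (u ≡ᵇ x) ∨ (v ≡ᵇ x)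

usedᵇ-++ : ∀ cs ds x → usedᵇ (cs ++ ds) x ≡ usedᵇ cs x ∨ usedᵇ ds x
usedᵇ-++ [] ds x = refl
usedᵇ-++ (c ∷ cs) ds x =
  trans (cong (endsAtᵇ c x ∨_) (usedᵇ-++ cs ds x)) (sym (∨-assoc (endsAtᵇ c x) _ _))

freePoints-∷ʳ : ∀ n cs x y →
  freePoints n (cs ∷ʳ (x , y)) ≡ filterᵇ (not ∘ (y ≡ᵇ_)) (filterᵇ (not ∘ (x ≡ᵇ_)) (freePoints n cs))
freePoints-∷ʳ n cs x y = begin
  filterᵇ (λ z → not (usedᵇ (cs ∷ʳ (x , y)) z)) (points n)
    ≡⟨ filterᵇ-cong (λ z → trans (cong not (usedᵇ-++ cs _ z)) (not-∨ (usedᵇ cs z) (x ≡ᵇ z) (y ≡ᵇ z)))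
                    (points n) ⟩
  filterᵇ (λ z → (not (usedᵇ cs z) ∧ not (x ≡ᵇ z)) ∧ not (y ≡ᵇ z)) (points n)
    ≡⟨ filterᵇ-filterᵇ _ _ (points n) ⟨
  filterᵇ (not ∘ (y ≡ᵇ_)) (filterᵇ (λ z → not (usedᵇ cs z) ∧ not (x ≡ᵇ z)) (points n))
    ≡⟨ cong (filterᵇ (not ∘ (y ≡ᵇ_))) (filterᵇ-filterᵇ _ _ (points n)) ⟨
  filterᵇ (not ∘ (y ≡ᵇ_)) (filterᵇ (not ∘ (x ≡ᵇ_)) (freePoints n cs))  ∎
  where
  open ≡-Reasoning
  not-∨ : ∀ p q r → not (p ∨ ((q ∨ r) ∨ false)) ≡ (not p ∧ not q) ∧ not r
  not-∨ true _ _ = refl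
  not-∨ false true _ = refl
  not-∨ false false r = cong not (∨-identityʳ r)

freePoints-increasing : ∀ n cs → AllPairs _<_ (freePoints n cs)
freePoints-increasing n cs = AllPairs.filter⁺ (T? ∘ _) (points-increasing n)

freePoints-unique : ∀ n cs → Unique (freePoints n cs)
freePoints-unique n cs = Unique.filter⁺ (T? ∘ _) (points-unique n)

endpoints-increasing : ∀ n cs → AllPairs _<_ (endpoints n cs)
endpoints-increasing n cs = AllPairs.filter⁺ (T? ∘ _) (points-increasing n)

∈-freePoints⁻ : ∀ n cs {x} → x ∈ freePoints n cs → x ∈ points n × T (not (usedᵇ cs x))
∈-freePoints⁻ n cs = ∈-filter⁻ (T? ∘ (not ∘ usedᵇ cs)) {xs = points n}

∈-freePoints⁺ : ∀ n cs {x} → x ∈ points n → T (not (usedᵇ cs x)) → x ∈ freePoints n cs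
∈-freePoints⁺ n cs = ∈-filter⁺ (T? ∘ (not ∘ usedᵇ cs))

∈-endpoints⁻ : ∀ n cs {x} → x ∈ endpoints n cs → x ∈ points n × T (usedᵇ cs x)
∈-endpoints⁻ n cs = ∈-filter⁻ (T? ∘ usedᵇ cs) {xs = points n}

freePoints-[] : ∀ n → freePoints n [] ≡ points n
freePoints-[] n = filter-all (T? ∘ _) (All.tabulate (λ _ → _))

length-freePoints-∷ʳ : ∀ n cs {x y} → x ∈ freePoints n cs → y ∈ freePoints n cs → x ≢ y →
                       2 + length (freePoints n (cs ∷ʳ (x , y))) ≡ length (freePoints n cs)
length-freePoints-∷ʳ n cs {x} {y} x∈ y∈ x≢y = begin
  2 + length (freePoints n (cs ∷ʳ (x , y)))
    ≡⟨ cong (λ l → 2 + length l) (freePoints-∷ʳ n cs x y) ⟩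
  suc (suc (length (filterᵇ (not ∘ (y ≡ᵇ_)) free-x)))
    ≡⟨ cong suc (length-filterᵇ-remove (Unique.filter⁺ (T? ∘ _) (freePoints-unique n cs)) y∈free-x) ⟩
  suc (length free-x)
    ≡⟨ length-filterᵇ-remove (freePoints-unique n cs) x∈ ⟩
  length (freePoints n cs)  ∎
  where
  open ≡-Reasoning
  free-x : List ℕ
  free-x = filterᵇ (not ∘ (x ≡ᵇ_)) (freePoints n cs)
  y∈free-x : y ∈ free-x
  y∈free-x = ∈-filter⁺ (T? ∘ _) y∈ (≢⇒T-not-≡ᵇ x≢y)

sortPair : ℕ → ℕ → Chord
sortPair u v = u ⊓ v , u ⊔ v

sortPair-comm : ∀ u v → sortPair u v ≡ sortPair v u
sortPair-comm u v = cong₂ _,_ (⊓-comm u v) (⊔-comm u v)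

sortPair-≤ : u ≤ v → sortPair u v ≡ (u , v)
sortPair-≤ u≤v = cong₂ _,_ (m≤n⇒m⊓n≡m u≤v) (m≤n⇒m⊔n≡n u≤v)

sortPair-cases : ∀ u v → sortPair u v ≡ (u , v) ⊎ sortPair u v ≡ (v , u)
sortPair-cases u v with ≤-total u v
... | inj₁ u≤v = inj₁ (sortPair-≤ u≤v)
... | inj₂ v≤u = inj₂ (trans (sortPair-comm u v) (sortPair-≤ v≤u))

sortPair-increasing : ∀ u v → u ≢ v → Increasing (sortPair u v)
sortPair-increasing u v u≢v with ≤-total u v
... | inj₁ u≤v = subst Increasing (sym (sortPair-≤ u≤v)) (≤∧≢⇒< u≤v u≢v)
... | inj₂ v≤u =
  subst Increasing (sym (trans (sortPair-comm u v) (sortPair-≤ v≤u))) (≤∧≢⇒< v≤u (u≢v ∘ sym))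

sortPair-∈-pairsOf : ∀ {l} → AllPairs _<_ l → u ∈ l → v ∈ l → u ≢ v → sortPair u v ∈ pairsOf l
sortPair-∈-pairsOf {u} {v} {l} l↑ u∈ v∈ u≢v with sortPair-cases u v | sortPair-increasing u v u≢v
... | inj₁ eq | ↑ = subst (_∈ pairsOf l) (sym eq) (∈-pairsOf⁺ l↑ u∈ v∈ (subst Increasing eq ↑))
... | inj₂ eq | ↑ = subst (_∈ pairsOf l) (sym eq) (∈-pairsOf⁺ l↑ v∈ u∈ (subst Increasing eq ↑))

endsAtᵇ-sortPair : ∀ u v x → endsAtᵇ (sortPair u v) x ≡ endsAtᵇ (u , v) x
endsAtᵇ-sortPair u v x with sortPair-cases u v
... | inj₁ eq = cong (λ c → endsAtᵇ c x) eq
... | inj₂ eq = trans (cong (λ c → endsAtᵇ c x) eq) (∨-comm (v ≡ᵇ x) (u ≡ᵇ x))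

partner-flip : ∀ u v cs x → partner ((v , u) ∷ cs) x ≡ partner ((u , v) ∷ cs) x
partner-flip u v cs x with v ≟ x | u ≟ x
... | yes refl | yes refl = refl
... | yes refl | no u≢x rewrite ≡ᵇ-true (refl {x = v}) | ≡ᵇ-false u≢x = refl
... | no v≢x | _ rewrite ≡ᵇ-false v≢x = refl

partner-sortPair : ∀ u v cs x → partner (sortPair u v ∷ cs) x ≡ partner ((u , v) ∷ cs) x
partner-sortPair u v cs x with sortPair-cases u v
... | inj₁ eq = cong (λ c → partner (c ∷ cs) x) eq
... | inj₂ eq = trans (cong (λ c → partner (c ∷ cs) x) eq) (partner-flip u v cs x)

-- Chords are kept as increasing pairs, the form in which the process creates them.
relabelChord : ℕ → ℕ → Chord → Chord
relabelChord a b (u , v) = sortPair (transpose a b u) (transpose a b v)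

relabel : ℕ → ℕ → List Chord → List Chord
relabel a b = map (relabelChord a b)

usedᵇ-relabel : ∀ a b cs x → usedᵇ (relabel a b cs) x ≡ usedᵇ cs (transpose a b x)
usedᵇ-relabel a b [] x = refl
usedᵇ-relabel a b ((u , v) ∷ cs) x = cong₂ _∨_ endsAt-relabelChord (usedᵇ-relabel a b cs x)
  where
  endsAt-relabelChord : endsAtᵇ (relabelChord a b (u , v)) x ≡ endsAtᵇ (u , v) (transpose a b x)
  endsAt-relabelChord rewrite endsAtᵇ-sortPair (transpose a b u) (transpose a b v) x
                            | ≡ᵇ-transpose a b u x | ≡ᵇ-transpose a b v x = refl

partner-relabel : ∀ a b cs x → partner (relabel a b cs) x ≡ transpose a b (partner cs (transpose a b x))
partner-relabel a b [] x = sym (transpose-involutive a b x)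
partner-relabel a b ((u , v) ∷ cs) x
  rewrite partner-sortPair (transpose a b u) (transpose a b v) (relabel a b cs) x
        | ≡ᵇ-transpose a b u x | ≡ᵇ-transpose a b v x
  with u ≡ᵇ transpose a b x
... | true = refl
... | false with v ≡ᵇ transpose a b x
...   | true = refl
...   | false = partner-relabel a b cs x

relabelChord-sortPair : ∀ a b u v →
                        relabelChord a b (sortPair u v) ≡ sortPair (transpose a b u) (transpose a b v)
relabelChord-sortPair a b u v with sortPair-cases u v
... | inj₁ eq = cong (relabelChord a b) eq
... | inj₂ eq = trans (cong (relabelChord a b) eq) (sortPair-comm _ _)

relabelChord-involutive : ∀ a b {c} → Increasing c → relabelChord a b (relabelChord a b c) ≡ c
relabelChord-involutive a b {u , v} u<v = begin
  relabelChord a b (sortPair (transpose a b u) (transpose a b v))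
    ≡⟨ relabelChord-sortPair a b (transpose a b u) (transpose a b v) ⟩
  sortPair (transpose a b (transpose a b u)) (transpose a b (transpose a b v))
    ≡⟨ cong₂ sortPair (transpose-involutive a b u) (transpose-involutive a b v) ⟩
  sortPair u v
    ≡⟨ sortPair-≤ (<⇒≤ u<v) ⟩
  (u , v)  ∎
  where open ≡-Reasoning

relabel-involutive : ∀ a b {cs} → All Increasing cs → relabel a b (relabel a b cs) ≡ cs
relabel-involutive a b [] = refl
relabel-involutive a b (c↑ ∷ cs↑) =
  cong₂ _∷_ (relabelChord-involutive a b c↑) (relabel-involutive a b cs↑)

transpose-∈-freePoints : ∀ n cs {a b x} → a ∈ points n → b ∈ points n → x ∈ freePoints n cs →
                         transpose a b x ∈ freePoints n (relabel a b cs)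
transpose-∈-freePoints n cs {a} {b} {x} a∈ b∈ x∈ with x∈pts , x-free ← ∈-freePoints⁻ n cs x∈ =
  ∈-freePoints⁺ n (relabel a b cs) (transpose-preserves (_∈ points n) a∈ b∈ x∈pts)
    (subst (T ∘ not) (sym (trans (usedᵇ-relabel a b cs _) (cong (usedᵇ cs) (transpose-involutive a b x))))
           x-free)

relabelChord-∈-pairsOf : ∀ n cs {a b c} → a ∈ points n → b ∈ points n → c ∈ pairsOf (freePoints n cs) →
                         relabelChord a b c ∈ pairsOf (freePoints n (relabel a b cs))
relabelChord-∈-pairsOf n cs {a} {b} a∈ b∈ c∈
  with x∈ , y∈ , x<y ← ∈-pairsOf⁻ (freePoints-increasing n cs) c∈ =
  sortPair-∈-pairsOf (freePoints-increasing n (relabel a b cs))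
    (transpose-∈-freePoints n cs a∈ b∈ x∈) (transpose-∈-freePoints n cs a∈ b∈ y∈)
    (<⇒≢ x<y ∘ transpose-injective a b)

endpoints-relabel : ∀ n cs {a b} → a ∈ endpoints n cs → b ∈ endpoints n cs →
                    endpoints n (relabel a b cs) ≡ endpoints n cs
endpoints-relabel n cs {a} {b} a∈ b∈ =
  filterᵇ-cong (λ z → trans (usedᵇ-relabel a b cs z) (transpose-invariant (usedᵇ cs) used-a≡used-b z))
               (points n)
  where
  used-a≡used-b : usedᵇ cs a ≡ usedᵇ cs b
  used-a≡used-b = trans (Equivalence.to T-≡ (proj₂ (∈-endpoints⁻ n cs a∈)))
                        (sym (Equivalence.to T-≡ (proj₂ (∈-endpoints⁻ n cs b∈))))

-- The outcomes of the process

support : Dist A → List A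
support = map proj₂

support-uniformOver : ∀ (xs : List A) → support (uniformOver xs) ≡ xs
support-uniformOver [] = refl
support-uniformOver (x ∷ xs) = trans (sym (map-∘ (x ∷ xs))) (map-id (x ∷ xs))

support-bind : ∀ (d : Dist A) (f : A → Dist B) →
               support (bind d f) ≡ concatMap (support ∘ f) (support d)
support-bind [] f = refl
support-bind ((w , x) ∷ d) f =
  trans (map-++ proj₂ (map (λ q → w ℚ.* proj₁ q , proj₂ q) (f x)) (bind d f))
        (cong₂ _++_ (sym (map-∘ (f x))) (support-bind d f))

extensions : ℕ → List Chord → List (List Chord)
extensions n cs = map (cs ∷ʳ_) (pairsOf (freePoints n cs))

support-laterStep : ∀ n cs → support (laterStep n cs) ≡ extensions n cs
support-laterStep n cs =
  trans (sym (map-∘ pairs))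
        (trans (map-∘ pairs) (cong (map (cs ∷ʳ_)) (support-uniformOver (pairsOf (freePoints n cs)))))
  where
  pairs : Dist Chord
  pairs = uniformOver (pairsOf (freePoints n cs))

outcomes : ℕ → ℕ → List (List Chord)
outcomes n k = support (chordsDist n k)

firstChoices : ℕ → List (List Chord)
firstChoices n = map (λ p → (1 , p) ∷ []) (filterᵇ (λ p → not (p ≡ᵇ 1)) (points n))

outcomes-1 : ∀ n → outcomes n 1 ≡ firstChoices n
outcomes-1 n = support-uniformOver (firstChoices n)

outcomes-2+ : ∀ n k → outcomes n (2 + k) ≡ concatMap (extensions n) (outcomes n (suc k))
outcomes-2+ n k = trans (support-bind (chordsDist n (suc k)) (laterStep n))
                        (cong List.concat (map-cong (support-laterStep n) (outcomes n (suc k))))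

data Reachable (n : ℕ) : ℕ → List Chord → Set where
  start  : Reachable n 0 []
  first  : p ∈ points n → 1 < p → Reachable n 1 ((1 , p) ∷ [])
  extend : Reachable n (suc k) cs → c ∈ pairsOf (freePoints n cs) → Reachable n (2 + k) (cs ∷ʳ c)

∈-outcomes⁻ : ∀ n k {cs} → cs ∈ outcomes n k → Reachable n k cs
∈-outcomes⁻ n zero (here refl) = start
∈-outcomes⁻ n (suc zero) cs∈
  with p , p∈ , refl ← ∈-map⁻ _ (subst (_ ∈_) (outcomes-1 n) cs∈)
  with p∈points , p≢1 ← ∈-filter⁻ (T? ∘ (not ∘ (_≡ᵇ 1))) {xs = points n} p∈
  = first p∈points (≤∧≢⇒< (points-positive n p∈points) (T-not-≡ᵇ⇒≢ p≢1 ∘ sym))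
∈-outcomes⁻ n (suc (suc k)) cs∈ =
  let cs₀ , cs₀∈ , cs∈ext = find (∈-concatMap⁻ (extensions n) (subst (_ ∈_) (outcomes-2+ n k) cs∈))
      c , c∈ , cs≡ = ∈-map⁻ (cs₀ ∷ʳ_) cs∈ext
  in subst (Reachable n (2 + k)) (sym cs≡) (extend (∈-outcomes⁻ n (suc k) cs₀∈) c∈)

∈-outcomes⁺ : Reachable n k cs → cs ∈ outcomes n k
∈-outcomes⁺ start = here refl
∈-outcomes⁺ {n} (first p∈ 1<p) =
  subst (_ ∈_) (sym (outcomes-1 n))
        (∈-map⁺ _ (∈-filter⁺ (T? ∘ (not ∘ (_≡ᵇ 1))) p∈ (≢⇒T-not-≡ᵇ (<⇒≢ 1<p ∘ sym))))
∈-outcomes⁺ {n} (extend {k} {cs} r c∈) =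
  subst (_ ∈_) (sym (outcomes-2+ n k))
        (∈-concatMap⁺ (extensions n) (lose (∈-outcomes⁺ r) (∈-map⁺ (cs ∷ʳ_) c∈)))

reachable-increasing : Reachable n k cs → All Increasing cs
reachable-increasing start = []
reachable-increasing (first _ 1<p) = 1<p ∷ []
reachable-increasing {n} (extend {cs = cs} r c∈) =
  ++⁺ (reachable-increasing r) (proj₂ (proj₂ (∈-pairsOf⁻ (freePoints-increasing n cs) c∈)) ∷ [])

length-freePoints : Reachable n k cs → length (freePoints n cs) + 2 * k ≡ 2 * n
length-freePoints {n} start =
  trans (+-comm _ 0) (trans (cong length (freePoints-[] n)) (length-points n))
length-freePoints {n} (first {p} p∈ 1<p) = begin
  length (freePoints n ((1 , p) ∷ [])) + 2
    ≡⟨ +-comm _ 2 ⟩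
  2 + length (freePoints n ([] ∷ʳ (1 , p)))
    ≡⟨ length-freePoints-∷ʳ n [] (free (1∈points {n = n} p∈)) (free p∈) (<⇒≢ 1<p) ⟩
  length (freePoints n [])
    ≡⟨ cong length (freePoints-[] n) ⟩
  length (points n)
    ≡⟨ length-points n ⟩
  2 * n  ∎
  where
  open ≡-Reasoning
  free : ∀ {x} → x ∈ points n → x ∈ freePoints n []
  free = subst (_ ∈_) (sym (freePoints-[] n))
length-freePoints {n} (extend {k} {cs} {x , y} r c∈)
  with x∈ , y∈ , x<y ← ∈-pairsOf⁻ (freePoints-increasing n cs) c∈ = begin
  length (freePoints n (cs ∷ʳ (x , y))) + 2 * (2 + k)
    ≡⟨ cong (length (freePoints n (cs ∷ʳ (x , y))) +_) (*-suc 2 (suc k)) ⟩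
  length (freePoints n (cs ∷ʳ (x , y))) + (2 + 2 * suc k)
    ≡⟨ +-assoc _ 2 (2 * suc k) ⟨
  length (freePoints n (cs ∷ʳ (x , y))) + 2 + 2 * suc k
    ≡⟨ cong (_+ 2 * suc k) (+-comm _ 2) ⟩
  2 + length (freePoints n (cs ∷ʳ (x , y))) + 2 * suc k
    ≡⟨ cong (_+ 2 * suc k) (length-freePoints-∷ʳ n cs x∈ y∈ (<⇒≢ x<y)) ⟩
  length (freePoints n cs) + 2 * suc k
    ≡⟨ length-freePoints r ⟩
  2 * n  ∎
  where open ≡-Reasoning

length-endpoints : Reachable n k cs → length (endpoints n cs) ≡ 2 * k
length-endpoints {n} {k} {cs} r = +-cancelʳ-≡ _ (length (endpoints n cs)) (2 * k) (begin
  length (endpoints n cs) + length (freePoints n cs)  ≡⟨ length-filterᵇ-partition (usedᵇ cs) (points n) ⟩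
  length (points n)                                   ≡⟨ length-points n ⟩
  2 * n                                               ≡⟨ length-freePoints r ⟨
  length (freePoints n cs) + 2 * k                    ≡⟨ +-comm _ (2 * k) ⟩
  2 * k + length (freePoints n cs)                    ∎)
  where open ≡-Reasoning

outcomes-unique : ∀ n k → Unique (outcomes n k)
outcomes-unique n zero = [] ∷ []
outcomes-unique n (suc zero) =
  subst Unique (sym (outcomes-1 n))
        (Unique.map⁺ (λ { refl → refl }) (Unique.filter⁺ (T? ∘ _) (points-unique n)))
outcomes-unique n (suc (suc k)) =
  subst Unique (sym (outcomes-2+ n k))
        (concatMap-unique (outcomes-unique n (suc k)) extensions-unique same-prefix)
  where
  extensions-unique : ∀ cs → Unique (extensions n cs)
  extensions-unique cs = Unique.map⁺ (∷ʳ-injectiveʳ cs cs) (pairsOf-unique (freePoints-unique n cs))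
  same-prefix : ∀ {cs cs′ ds} → ds ∈ extensions n cs → ds ∈ extensions n cs′ → cs ≡ cs′
  same-prefix {cs} {cs′} ds∈ ds∈′
    with _ , _ , refl ← ∈-map⁻ (cs ∷ʳ_) ds∈ | _ , _ , eq ← ∈-map⁻ (cs′ ∷ʳ_) ds∈′ =
    ∷ʳ-injectiveˡ cs cs′ eq

reachable-relabel : 1 < a → 1 < b → a ∈ points n → b ∈ points n →
                    Reachable n k cs → Reachable n k (relabel a b cs)
reachable-relabel _ _ _ _ start = start
reachable-relabel {a} {b} {n} 1<a 1<b a∈ b∈ (first {p} p∈ 1<p) =
  subst (Reachable n 1) (sym relabel-first) (first (transpose-preserves (_∈ points n) a∈ b∈ p∈) 1<σp)
  where
  1<σp : 1 < transpose a b p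
  1<σp = transpose-preserves (1 <_) 1<a 1<b 1<p
  relabel-first : relabel a b ((1 , p) ∷ []) ≡ (1 , transpose a b p) ∷ []
  relabel-first =
    cong (_∷ []) (trans (cong (λ x → sortPair x (transpose a b p)) (transpose-other (<⇒≢ 1<a) (<⇒≢ 1<b)))
                        (sortPair-≤ (<⇒≤ 1<σp)))
reachable-relabel {a} {b} {n} 1<a 1<b a∈ b∈ (extend {cs = cs} {c} r c∈) =
  subst (Reachable n _) (sym (map-++ (relabelChord a b) cs (c ∷ [])))
        (extend (reachable-relabel 1<a 1<b a∈ b∈ r) (relabelChord-∈-pairsOf n cs a∈ b∈ c∈))

ConstantWeight : ℚ → Dist A → Set
ConstantWeight w d = ∀ {p} → p ∈ d → proj₁ p ≡ w

uniformWeight : ℕ → ℚ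
uniformWeight zero = 0ℚ
uniformWeight (suc m) = ℤ.+ 1 ℚ./ suc m

uniformOver-constantWeight : ∀ (xs : List A) → ConstantWeight (uniformWeight (length xs)) (uniformOver xs)
uniformOver-constantWeight (x ∷ xs) p∈ with _ , _ , refl ← ∈-map⁻ _ p∈ = refl

bind-constantWeight : ∀ {d : Dist A} {f : A → Dist B} {v w} → ConstantWeight v d →
                      (∀ {x} → x ∈ support d → ConstantWeight w (f x)) → ConstantWeight (v ℚ.* w) (bind d f)
bind-constantWeight {d = d} cw-d cw-f r∈
  with _ , q∈d , r∈map ← find (∈-concatMap⁻ _ {xs = d} r∈)
  with q , q∈ , refl ← ∈-map⁻ _ r∈map
  = cong₂ ℚ._*_ (cw-d q∈d) (cw-f (∈-map⁺ proj₂ q∈d) q∈)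

laterStep-constantWeight : Reachable n (suc k) cs →
                           ConstantWeight (uniformWeight ((2 * n ∸ 2 * suc k) C 2)) (laterStep n cs)
laterStep-constantWeight {n} {k} {cs} r p∈ with wc , wc∈ , refl ← ∈-map⁻ _ p∈ =
  trans (uniformOver-constantWeight (pairsOf (freePoints n cs)) wc∈)
        (cong uniformWeight (trans (length-pairsOf (freePoints n cs)) (cong (_C 2) length-free)))
  where
  length-free : length (freePoints n cs) ≡ 2 * n ∸ 2 * suc k
  length-free = trans (sym (m+n∸n≡m _ (2 * suc k))) (cong (_∸ 2 * suc k) (length-freePoints r))

chordsDist-constantWeight : ∀ n k → ∃[ w ] ConstantWeight w (chordsDist n k)
chordsDist-constantWeight n zero = 1ℚ , λ { (here refl) → refl }
chordsDist-constantWeight n (suc zero) = _ , uniformOver-constantWeight (firstChoices n)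
chordsDist-constantWeight n (suc (suc k)) =
  _ , bind-constantWeight (proj₂ (chordsDist-constantWeight n (suc k)))
                          (λ x∈ → laterStep-constantWeight (∈-outcomes⁻ n (suc k) x∈))

sumℚ-constantWeight : ∀ {d : Dist A} {w} → ConstantWeight w d → (q : A → Bool) →
                      sumℚ (map (λ p → if q (proj₂ p) then proj₁ p else 0ℚ) d) ≡
                      sumℚ (map (λ x → if q x then w else 0ℚ) (support d))
sumℚ-constantWeight {d = d} cw q = cong sumℚ (trans
  (map-cong-local (All.tabulate (λ {p} p∈ → cong (if q (proj₂ p) then_else 0ℚ) (cw p∈))))
  (map-∘ d))

-- Exchanging two endpoints

partnerIndex : ℕ → List Chord → ℕ → ℕ
partnerIndex n cs i = indexOf (partner cs (nth (endpoints n cs) i)) (endpoints n cs)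

tau-partnerIndex : ∀ n cs → tau n cs ≡ applyUpTo (partnerIndex n cs) (length (endpoints n cs))
tau-partnerIndex n cs = begin
  map h es                                ≡⟨ cong (map h) (applyUpTo-nth es) ⟨
  map h (applyUpTo (nth es) (length es))  ≡⟨ map-applyUpTo (nth es) h (length es) ⟩
  applyUpTo (h ∘ nth es) (length es)      ∎
  where
  open ≡-Reasoning
  es : List ℕ
  es = endpoints n cs
  h : ℕ → ℕ
  h x = indexOf (partner cs x) es

tau-reachable : Reachable n k cs → tau n cs ≡ applyUpTo (partnerIndex n cs) (2 * k)
tau-reachable {n} {k} {cs} r =
  trans (tau-partnerIndex n cs) (cong (applyUpTo (partnerIndex n cs)) (length-endpoints r))

-- s and t are 0-based positions in the clockwise list of endpoints; positions other than 0
-- never move point 1, which the first step treats specially.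
swapPositions : ℕ → ℕ → ℕ → List Chord → List Chord
swapPositions n s t cs = relabel (nth (endpoints n cs) s) (nth (endpoints n cs) t) cs

module _ (r : Reachable n k cs) (s<2k : s < 2 * k) (t<2k : t < 2 * k) where

  private
    es : List ℕ
    es = endpoints n cs
    es-unique : Unique es
    es-unique = AllPairs.map <⇒≢ (endpoints-increasing n cs)
    eₛ eₜ : ℕ
    eₛ = nth es s
    eₜ = nth es t
    position< : ∀ {i} → i < 2 * k → i < length es
    position< {i} i<2k = subst (i <_) (sym (length-endpoints r)) i<2k

  endpoints-swapPositions : endpoints n (swapPositions n s t cs) ≡ es
  endpoints-swapPositions = endpoints-relabel n cs (nth-∈ es (position< s<2k)) (nth-∈ es (position< t<2k))

  swapPositions-involutive : swapPositions n s t (swapPositions n s t cs) ≡ cs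
  swapPositions-involutive =
    trans (cong (λ es′ → relabel (nth es′ s) (nth es′ t) (swapPositions n s t cs)) endpoints-swapPositions)
          (relabel-involutive _ _ (reachable-increasing r))

  partnerIndex-swapPositions : ∀ i → i < 2 * k →
    partnerIndex n (swapPositions n s t cs) i ≡ conjugate s t (partnerIndex n cs) i
  partnerIndex-swapPositions i i<2k = begin
    indexOf (partner (relabel eₛ eₜ cs) (nth es′ i)) es′
      ≡⟨ cong (λ l → indexOf (partner (relabel eₛ eₜ cs) (nth l i)) l) endpoints-swapPositions ⟩
    indexOf (partner (relabel eₛ eₜ cs) (nth es i)) es
      ≡⟨ cong (λ x → indexOf x es) (partner-relabel eₛ eₜ cs (nth es i)) ⟩
    indexOf (transpose eₛ eₜ (partner cs (transpose eₛ eₜ (nth es i)))) es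
      ≡⟨ indexOf-transpose es-unique (position< s<2k) (position< t<2k) _ ⟩
    transpose s t (indexOf (partner cs (transpose eₛ eₜ (nth es i))) es)
      ≡⟨ cong (λ x → transpose s t (indexOf (partner cs x) es))
              (nth-transpose es-unique (position< s<2k) (position< t<2k) (position< i<2k)) ⟨
    transpose s t (partnerIndex n cs (transpose s t i))  ∎
    where
    open ≡-Reasoning
    es′ : List ℕ
    es′ = endpoints n (relabel eₛ eₜ cs)

  swapPositions-reachable : 1 ≤ s → 1 ≤ t → Reachable n k (swapPositions n s t cs)
  swapPositions-reachable 1≤s 1≤t =
    reachable-relabel (1<nth 1≤s s<2k) (1<nth 1≤t t<2k) (nth∈points s<2k) (nth∈points t<2k) r
    where
    nth∈points : ∀ {i} → i < 2 * k → nth es i ∈ points n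
    nth∈points i<2k = proj₁ (∈-endpoints⁻ n cs (nth-∈ es (position< i<2k)))
    1<nth : ∀ {i} → 1 ≤ i → i < 2 * k → 1 < nth es i
    1<nth 1≤i i<2k = ≤-<-trans (points-positive n (nth∈points (<-trans 1≤i i<2k)))
                               (nth-increasing (endpoints-increasing n cs) 1≤i (position< i<2k))

  tau-swapPositions : tau n (swapPositions n s t cs) ≡ applyUpTo (conjugate s t (partnerIndex n cs)) (2 * k)
  tau-swapPositions = begin
    tau n Φcs
      ≡⟨ tau-partnerIndex n Φcs ⟩
    applyUpTo (partnerIndex n Φcs) (length (endpoints n Φcs))
      ≡⟨ cong (applyUpTo (partnerIndex n Φcs)) length-es′ ⟩
    applyUpTo (partnerIndex n Φcs) (2 * k)
      ≡⟨ applyUpTo-cong (2 * k) partnerIndex-swapPositions ⟩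
    applyUpTo (conjugate s t (partnerIndex n cs)) (2 * k)  ∎
    where
    open ≡-Reasoning
    Φcs : List Chord
    Φcs = swapPositions n s t cs
    length-es′ : length (endpoints n Φcs) ≡ 2 * k
    length-es′ = trans (cong length endpoints-swapPositions) (length-endpoints r)

  tau-swapPositions-≡ : ∀ f → tau n (swapPositions n s t cs) ≡ applyUpTo f (2 * k) ⇔
                             tau n cs ≡ applyUpTo (conjugate s t f) (2 * k)
  tau-swapPositions-≡ f =
    subst₂ (λ X Y → X ≡ applyUpTo f (2 * k) ⇔ Y ≡ applyUpTo (conjugate s t f) (2 * k))
           (sym tau-swapPositions) (sym (tau-reachable r))
           (applyUpTo-conjugate f (partnerIndex n cs) s<2k t<2k)

-- probTau n k D is probOf n k (encode D) by definition.
probOf : ℕ → ℕ → List ℕ → ℚ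
probOf n k T =
  sumℚ (map (λ p → if ⌊ ≡-dec _≟_ (tau n (proj₂ p)) T ⌋ then proj₁ p else 0ℚ) (chordsDist n k))

probOf-conjugate : ∀ n k {s t} f → 1 ≤ s → 1 ≤ t → s < 2 * k → t < 2 * k →
                   probOf n k (applyUpTo f (2 * k)) ≡ probOf n k (applyUpTo (conjugate s t f) (2 * k))
probOf-conjugate n k {s} {t} f 1≤s 1≤t s<2k t<2k = begin
  probOf n k Tf
    ≡⟨ sumℚ-constantWeight cw _ ⟩
  sumℚ (map (indicator Tf) (outcomes n k))
    ≡⟨ sumℚ-map-involution Φ Φ-closed Φ-involutive (outcomes-unique n k) _ ⟩
  sumℚ (map (indicator Tf ∘ Φ) (outcomes n k))
    ≡⟨ cong sumℚ (map-cong-local (All.tabulate indicator-Φ)) ⟩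
  sumℚ (map (indicator Tg) (outcomes n k))
    ≡⟨ sumℚ-constantWeight cw _ ⟨
  probOf n k Tg  ∎
  where
  open ≡-Reasoning
  Tf Tg : List ℕ
  Tf = applyUpTo f (2 * k)
  Tg = applyUpTo (conjugate s t f) (2 * k)
  w : ℚ
  w = proj₁ (chordsDist-constantWeight n k)
  cw : ConstantWeight w (chordsDist n k)
  cw = proj₂ (chordsDist-constantWeight n k)
  matches? : ∀ T cs → Dec (tau n cs ≡ T)
  matches? T cs = ≡-dec _≟_ (tau n cs) T
  indicator : List ℕ → List Chord → ℚ
  indicator T cs = if ⌊ matches? T cs ⌋ then w else 0ℚ
  Φ : List Chord → List Chord
  Φ = swapPositions n s t
  Φ-closed : ∀ {cs} → cs ∈ outcomes n k → Φ cs ∈ outcomes n k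
  Φ-closed cs∈ = ∈-outcomes⁺ (swapPositions-reachable (∈-outcomes⁻ n k cs∈) s<2k t<2k 1≤s 1≤t)
  Φ-involutive : ∀ {cs} → cs ∈ outcomes n k → Φ (Φ cs) ≡ cs
  Φ-involutive cs∈ = swapPositions-involutive (∈-outcomes⁻ n k cs∈) s<2k t<2k
  indicator-Φ : ∀ {cs} → cs ∈ outcomes n k → indicator Tf (Φ cs) ≡ indicator Tg cs
  indicator-Φ {cs} cs∈ = cong (if_then w else 0ℚ) (begin
    ⌊ matches? Tf (Φ cs) ⌋
      ≡⟨ isYes≗does (matches? Tf (Φ cs)) ⟩
    does (matches? Tf (Φ cs))
      ≡⟨ does-⇔ (tau-swapPositions-≡ (∈-outcomes⁻ n k cs∈) s<2k t<2k f) (matches? Tf (Φ cs)) (matches? Tg cs) ⟩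
    does (matches? Tg cs)
      ≡⟨ isYes≗does (matches? Tg cs) ⟨
    ⌊ matches? Tg cs ⌋  ∎)

-- Chord diagrams

nth-encode : ∀ {m N} (D : Vec (Fin N) m) i → nth (toList (Vec.map toℕ D)) (toℕ i) ≡ toℕ (lookup D i)
nth-encode (x Vec.∷ D) Fin.zero = refl
nth-encode (x Vec.∷ D) (Fin.suc i) = nth-encode D i

encode-applyUpTo : ∀ {m} (D : Vec (Fin m) m) → encode D ≡ applyUpTo (nth (encode D)) m
encode-applyUpTo D =
  trans (sym (applyUpTo-nth (encode D))) (cong (applyUpTo (nth (encode D))) (length-toList (Vec.map toℕ D)))

isChordDiagram⇒isMatching : ∀ {m} {D : Vec (Fin m) m} → IsChordDiagram D → IsMatching m (nth (encode D))
isChordDiagram⇒isMatching {m} {D} isDiagram i i<m =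
  subst (_< m) (sym D[i]) (toℕ<n (lookup D i′)) ,
  trans (cong (nth (encode D)) D[i])
        (trans (nth-encode D (lookup D i′)) (trans (cong toℕ involutive) toℕ-i′)) ,
  λ D[i]≡i → fixed-point-free (toℕ-injective (trans (sym D[i]) (trans D[i]≡i (sym toℕ-i′))))
  where
  i′ : Fin m
  i′ = fromℕ< i<m
  toℕ-i′ : toℕ i′ ≡ i
  toℕ-i′ = toℕ-fromℕ< i<m
  D[i] : nth (encode D) i ≡ toℕ (lookup D i′)
  D[i] = trans (cong (nth (encode D)) (sym toℕ-i′)) (nth-encode D i′)
  involutive : lookup D (lookup D i′) ≡ i′
  involutive = proj₁ (isDiagram i′)
  fixed-point-free : lookup D i′ ≢ i′
  fixed-point-free = proj₂ (isDiagram i′)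

probTau-standard : ∀ n k {D : Vec (Fin (2 * k)) (2 * k)} → IsChordDiagram D →
                   probTau n k D ≡ probOf n k (applyUpTo standardMatching (2 * k))
probTau-standard n k {D} isDiagram =
  trans (cong (probOf n k) (encode-applyUpTo D))
        (conjugation-invariant⇒standard k (λ f → probOf n k (applyUpTo f (2 * k)))
           (cong (probOf n k) ∘ applyUpTo-cong (2 * k)) (probOf-conjugate n k)
           (isChordDiagram⇒isMatching {D = D} isDiagram))

mainTheorem18 : (n k : ℕ) → 1 ≤ k → k ≤ n →
    (D D′ : Vec (Fin (2 * k)) (2 * k)) → IsChordDiagram D → IsChordDiagram D′ →
    probTau n k D ≡ probTau n k D′
mainTheorem18 n k _ _ D D′ isDiagram isDiagram′ =
  trans (probTau-standard n k isDiagram) (sym (probTau-standard n k isDiagram′))
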